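{- Let $Ag$ be a finite set of agents and $V$ a set of propositional variables; all formulas below are in $\mathcal{L}^{Ag}_V$. 1. For every $j \in Ag$, $[j]$ is an S5-modality with respect to $\vdash$: all S5 axiom instances for $[j]$ are derivable and, whenever $\vdash A$, also $\vdash [j]A$. 2. Let $A, B_1,\ldots,B_n, C$ be formulas and let $i_1,\ldots,i_n, j \in Ag$ be pairwise different. If $\vdash (\Box A \wedge [i_1]B_1 \wedge\dots\wedge [i_n]B_n) \to \neg C$, then $\vdash (\Box A \wedge \Diamond[i_1]B_1 \wedge\dots\wedge \Diamond[i_n]B_n) \to \neg\Diamond[j]C$. 3. Let $A,B,C$ be formulas and $j \in Ag$. If $\vdash (\Box A \wedge [j]B) \to C$, then $\vdash (\Box A \wedge \Diamond[j]B) \to \Diamond[j]C$.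
   Context: $\mathcal{L}^{Ag}_V$ is the set of stit formulas given by $A ::= p \mid A \to A \mid \bot \mid \Box A \mid [j]A$ with $p \in V$, $j \in Ag$ (other Boolean connectives defined as usual; $\Diamond A := \neg\Box\neg A$). $\vdash A$ means derivability in the axiom system $\mathbb{S}$ with axioms: all classical propositional tautologies; S5 axioms for $\Box$ and for each $[j]$, $j\in Ag$; $\Box A \to [j]A$ for each $j \in Ag$; and $(\Diamond[j_1]A_1 \wedge\dots\wedge \Diamond[j_k]A_k) \to \Diamond([j_1]A_1\wedge\dots\wedge[j_k]A_k)$ for pairwise distinct $j_1,\dots,j_k \in Ag$; rules: modus ponens and necessitation for $\Box$ (from $A$ infer $\Box A$). -}

module Defs where

open import Data.Nat using (ℕ)
open import Data.Fin using (Fin)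
open import Data.Bool using (Bool; true; false; _∧_; not)
open import Data.Bool renaming (_∨_ to _or_)
open import Data.List using (List; []; _∷_; map; foldr)
open import Data.List.Relation.Unary.Unique.Propositional using (Unique)
open import Data.Product using (_×_; _,_; proj₁; proj₂)
open import Relation.Binary.PropositionalEquality using (_≡_)

data Form (V : Set) (m : ℕ) : Set where
  var  : V → Form V m
  _⇒_  : Form V m → Form V m → Form V m
  ⊥'   : Form V m
  □    : Form V m → Form V m
  [_]_ : Fin m → Form V m → Form V m

infixr 5 _⇒_
infix 9 [_]_

module _ {V : Set} {m : ℕ} where
  ¬' : Form V m → Form V m
  ¬' A = A ⇒ ⊥'

  ⊤' : Form V m
  ⊤' = ¬' ⊥'

  infixr 6 _∧'_
  _∧'_ : Form V m → Form V m → Form V m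
  A ∧' B = ¬' (A ⇒ ¬' B)

  ◇ : Form V m → Form V m
  ◇ A = ¬' (□ (¬' A))

  ⋀ : List (Form V m) → Form V m
  ⋀ = foldr _∧'_ ⊤'

  -- Boolean evaluation treating variables and modal formulas as atoms;
  -- a (classical propositional) tautology is a formula true under every such assignment,
  -- i.e. a substitution instance of a propositional tautology.
  eval : (Form V m → Bool) → Form V m → Bool
  eval v (var p)   = v (var p)
  eval v (A ⇒ B)   = not (eval v A) or eval v B
  eval v ⊥'        = false
  eval v (□ A)     = v (□ A)
  eval v ([ j ] A) = v ([ j ] A)

  Tautology : Form V m → Set
  Tautology A = (v : Form V m → Bool) → eval v A ≡ true

  data ⊢_ : Form V m → Set where
    taut  : ∀ {A} → Tautology A → ⊢ A
    □K    : ∀ A B → ⊢ (□ (A ⇒ B) ⇒ □ A ⇒ □ B)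
    □T    : ∀ A → ⊢ (□ A ⇒ A)
    □4    : ∀ A → ⊢ (□ A ⇒ □ (□ A))
    □5    : ∀ A → ⊢ (◇ A ⇒ □ (◇ A))
    agK   : ∀ j A B → ⊢ ([ j ] (A ⇒ B) ⇒ [ j ] A ⇒ [ j ] B)
    agT   : ∀ j A → ⊢ ([ j ] A ⇒ A)
    ag4   : ∀ j A → ⊢ ([ j ] A ⇒ [ j ] ([ j ] A))
    ag5   : ∀ j A → ⊢ (¬' ([ j ] (¬' A)) ⇒ [ j ] (¬' ([ j ] (¬' A))))
    box-ag : ∀ j A → ⊢ (□ A ⇒ [ j ] A)
    indep : (l : List (Fin m × Form V m)) → Unique (map proj₁ l) →
            ⊢ (⋀ (map (λ p → ◇ ([ proj₁ p ] proj₂ p)) l)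
               ⇒ ◇ (⋀ (map (λ p → [ proj₁ p ] proj₂ p) l)))
    mp    : ∀ {A B} → ⊢ (A ⇒ B) → ⊢ A → ⊢ B
    nec   : ∀ {A} → ⊢ A → ⊢ □ A

  infix 2 ⊢_

  ⟨_⟩ : Fin m → Form V m → Form V m
  ⟨ j ⟩ A = ¬' ([ j ] (¬' A))

-- By □4 and □A → [j]A we have □A → □□A and □A → [j]□A, so a fixed context □A can be pushed
-- inside [j] and inside ◇.  Part 3 is then K for [j] together with [j]4, lifted through ◇.
-- For part 2, the hypothesis and [j]C → C make [j]C ∧ ⋀[iₖ]Bₖ inconsistent with □A, hence so
-- is its possibility; by independence of the distinct agents j, i₁, …, iₙ, that possibility
-- follows from ◇[j]C ∧ ⋀◇[iₖ]Bₖ.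
module Submission where

open import Defs
open import Data.Bool using (Bool; true; false; not; _∧_; _∨_; T)
open import Data.Bool.Properties using (T-≡; T-∧)
open import Data.Fin using (Fin)
open import Data.List using (List; _∷_; map)
open import Data.List.Relation.Unary.Unique.Propositional using (Unique)
open import Data.Nat using (ℕ; zero; suc)
open import Data.Product using (_×_; _,_; proj₁; proj₂)
open import Function.Bundles using (Equivalence)
open import Relation.Binary.PropositionalEquality using (_≡_)

-- Boolean counterparts of ⇒, ¬' and ∧', chosen so that eval commutes with them definitionally.
infixr 5 _⊃_
infixr 6 _&_

_⊃_ : Bool → Bool → Bool
x ⊃ y = not x ∨ y

~_ : Bool → Bool
~ x = x ⊃ false

_&_ : Bool → Bool → Bool
x & y = ~ (x ⊃ ~ y)

Bools : ℕ → Set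
Bools zero    = Bool
Bools (suc n) = Bool → Bools n

Valid : (n : ℕ) → Bools n → Set
Valid zero    b = b ≡ true
Valid (suc n) f = ∀ x → Valid n (f x)

valid? : (n : ℕ) → Bools n → Bool
valid? zero    b = b
valid? (suc n) f = valid? n (f true) ∧ valid? n (f false)

valid?-sound : ∀ n (f : Bools n) → T (valid? n f) → Valid n f
valid?-sound zero    b t       = Equivalence.to T-≡ t
valid?-sound (suc n) f t true  = valid?-sound n (f true)  (proj₁ (Equivalence.to T-∧ t))
valid?-sound (suc n) f t false = valid?-sound n (f false) (proj₂ (Equivalence.to T-∧ t))

-- The implicit argument is solved by η for ⊤ once valid? n f computes to true.
truth-table : ∀ n (f : Bools n) {_ : T (valid? n f)} → Valid n f
truth-table n f {t} = valid?-sound n f t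

module _ {V : Set} {m : ℕ} where

  mp₂ : {A B C : Form V m} → ⊢ A ⇒ B ⇒ C → ⊢ A → ⊢ B → ⊢ C
  mp₂ t a b = mp (mp t a) b

  ⇒-trans : {A B C : Form V m} → ⊢ A ⇒ B → ⊢ B ⇒ C → ⊢ A ⇒ C
  ⇒-trans {A} {B} {C} = mp₂ (taut λ v →
    truth-table 3 (λ a b c → (a ⊃ b) ⊃ (b ⊃ c) ⊃ a ⊃ c) (eval v A) (eval v B) (eval v C))

  ⇒-compose₂ : {P A B C : Form V m} → ⊢ P ⇒ B ⇒ C → ⊢ A ⇒ B → ⊢ P ⇒ A ⇒ C
  ⇒-compose₂ {P} {A} {B} {C} = mp₂ (taut λ v →
    truth-table 4 (λ p a b c → (p ⊃ b ⊃ c) ⊃ (a ⊃ b) ⊃ p ⊃ a ⊃ c)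
      (eval v P) (eval v A) (eval v B) (eval v C))

  ⇒-contrapose₂ : {P A B : Form V m} → ⊢ P ⇒ A ⇒ B → ⊢ P ⇒ ¬' B ⇒ ¬' A
  ⇒-contrapose₂ {P} {A} {B} = mp (taut λ v →
    truth-table 3 (λ p a b → (p ⊃ a ⊃ b) ⊃ p ⊃ ~ b ⊃ ~ a) (eval v P) (eval v A) (eval v B))

  ∧-curry : {A B C : Form V m} → ⊢ (A ∧' B) ⇒ C → ⊢ A ⇒ B ⇒ C
  ∧-curry {A} {B} {C} = mp (taut λ v →
    truth-table 3 (λ a b c → ((a & b) ⊃ c) ⊃ a ⊃ b ⊃ c) (eval v A) (eval v B) (eval v C))

  ∧-uncurry : {A B C : Form V m} → ⊢ A ⇒ B ⇒ C → ⊢ (A ∧' B) ⇒ C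
  ∧-uncurry {A} {B} {C} = mp (taut λ v →
    truth-table 3 (λ a b c → (a ⊃ b ⊃ c) ⊃ (a & b) ⊃ c) (eval v A) (eval v B) (eval v C))

  ¬¬-intro : {P A : Form V m} → ⊢ P ⇒ A → ⊢ P ⇒ ¬' (¬' A)
  ¬¬-intro {P} {A} = mp (taut λ v →
    truth-table 2 (λ p a → (p ⊃ a) ⊃ p ⊃ ~ ~ a) (eval v P) (eval v A))

  ¬∧-intro : {P Q C D : Form V m} → ⊢ (P ∧' Q) ⇒ ¬' C → ⊢ D ⇒ C → ⊢ P ⇒ ¬' (D ∧' Q)
  ¬∧-intro {P} {Q} {C} {D} = mp₂ (taut λ v →
    truth-table 4 (λ p q c d → ((p & q) ⊃ ~ c) ⊃ (d ⊃ c) ⊃ p ⊃ ~ (d & q))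
      (eval v P) (eval v Q) (eval v C) (eval v D))

  modus-tollens-∧ : {P Q X Z : Form V m} → ⊢ P ⇒ ¬' Z → ⊢ (X ∧' Q) ⇒ Z → ⊢ (P ∧' Q) ⇒ ¬' X
  modus-tollens-∧ {P} {Q} {X} {Z} = mp₂ (taut λ v →
    truth-table 4 (λ p q x z → (p ⊃ ~ z) ⊃ ((x & q) ⊃ z) ⊃ (p & q) ⊃ ~ x)
      (eval v P) (eval v Q) (eval v X) (eval v Z))

  □-mono : {A B : Form V m} → ⊢ A ⇒ B → ⊢ □ A ⇒ □ B
  □-mono {A} {B} h = mp (□K A B) (nec h)

  □-mono₂ : {A B C : Form V m} → ⊢ A ⇒ B ⇒ C → ⊢ □ A ⇒ □ B ⇒ □ C
  □-mono₂ {B = B} {C} h = ⇒-trans (□-mono h) (□K B C)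

  []-nec : (j : Fin m) {A : Form V m} → ⊢ A → ⊢ [ j ] A
  []-nec j {A} h = mp (box-ag j A) (nec h)

  []-mono₂ : (j : Fin m) {A B C : Form V m} → ⊢ A ⇒ B ⇒ C → ⊢ [ j ] A ⇒ [ j ] B ⇒ [ j ] C
  []-mono₂ j {A} {B} {C} h = ⇒-trans (mp (agK j A (B ⇒ C)) ([]-nec j h)) (agK j B C)

  ◇-mono₂ : {P A B : Form V m} → ⊢ P ⇒ A ⇒ B → ⊢ □ P ⇒ ◇ A ⇒ ◇ B
  ◇-mono₂ h = ⇒-contrapose₂ (□-mono₂ (⇒-contrapose₂ h))

  □⇒[]□ : (j : Fin m) (A : Form V m) → ⊢ □ A ⇒ [ j ] (□ A)
  □⇒[]□ j A = ⇒-trans (□4 A) (box-ag j (□ A))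

  []-mono-under-□ : (j : Fin m) {A B C : Form V m} →
    ⊢ □ A ⇒ B ⇒ C → ⊢ □ A ⇒ [ j ] B ⇒ [ j ] C
  []-mono-under-□ j {A} h = ⇒-trans (□⇒[]□ j A) ([]-mono₂ j h)

  ◇-mono-under-□ : {A B C : Form V m} → ⊢ □ A ⇒ B ⇒ C → ⊢ □ A ⇒ ◇ B ⇒ ◇ C
  ◇-mono-under-□ {A} h = ⇒-trans (□4 A) (◇-mono₂ h)

  ¬◇-under-□ : {A B : Form V m} → ⊢ □ A ⇒ ¬' B → ⊢ □ A ⇒ ¬' (◇ B)
  ¬◇-under-□ {A} h = ¬¬-intro (⇒-trans (□4 A) (□-mono h))

  []-isS5 : (j : Fin m) →
    ((A B : Form V m) → ⊢ ([ j ] (A ⇒ B) ⇒ [ j ] A ⇒ [ j ] B))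
    × ((A : Form V m) → ⊢ ([ j ] A ⇒ A))
    × ((A : Form V m) → ⊢ ([ j ] A ⇒ [ j ] ([ j ] A)))
    × ((A : Form V m) → ⊢ (⟨ j ⟩ A ⇒ [ j ] (⟨ j ⟩ A)))
    × ((A : Form V m) → ⊢ A → ⊢ [ j ] A)
  []-isS5 j = agK j , agT j , ag4 j , ag5 j , λ _ → []-nec j

  ¬◇[]-from-independence : (A C : Form V m) (Bs : List (Fin m × Form V m)) (j : Fin m) →
    Unique (j ∷ map proj₁ Bs) →
    ⊢ ((□ A ∧' ⋀ (map (λ p → [ proj₁ p ] proj₂ p) Bs)) ⇒ ¬' C) →
    ⊢ ((□ A ∧' ⋀ (map (λ p → ◇ ([ proj₁ p ] proj₂ p)) Bs)) ⇒ ¬' (◇ ([ j ] C)))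
  ¬◇[]-from-independence A C Bs j distinct h =
    modus-tollens-∧ (¬◇-under-□ (¬∧-intro h (agT j C))) (indep ((j , C) ∷ Bs) distinct)

  ◇[]-mono-under-□ : (A B C : Form V m) (j : Fin m) →
    ⊢ ((□ A ∧' [ j ] B) ⇒ C) →
    ⊢ ((□ A ∧' ◇ ([ j ] B)) ⇒ ◇ ([ j ] C))
  ◇[]-mono-under-□ A B C j h =
    ∧-uncurry (◇-mono-under-□ (⇒-compose₂ ([]-mono-under-□ j (∧-curry h)) (ag4 j B)))

lemma2 : (V : Set) (m : ℕ) →
    -- (1) each [j] is an S5 modality w.r.t. ⊢
    ((j : Fin m) →
      ((A B : Form V m) → ⊢ ([ j ] (A ⇒ B) ⇒ [ j ] A ⇒ [ j ] B))
      × ((A : Form V m) → ⊢ ([ j ] A ⇒ A))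
      × ((A : Form V m) → ⊢ ([ j ] A ⇒ [ j ] ([ j ] A)))
      × ((A : Form V m) → ⊢ (⟨ j ⟩ A ⇒ [ j ] (⟨ j ⟩ A)))
      × ((A : Form V m) → ⊢ A → ⊢ [ j ] A))
    -- (2)
    × ((A C : Form V m) (Bs : List (Fin m × Form V m)) (j : Fin m) →
       Unique (j ∷ map proj₁ Bs) →
       ⊢ ((□ A ∧' ⋀ (map (λ p → [ proj₁ p ] proj₂ p) Bs)) ⇒ ¬' C) →
       ⊢ ((□ A ∧' ⋀ (map (λ p → ◇ ([ proj₁ p ] proj₂ p)) Bs)) ⇒ ¬' (◇ ([ j ] C))))
    -- (3)
    × ((A B C : Form V m) (j : Fin m) →
       ⊢ ((□ A ∧' [ j ] B) ⇒ C) →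
       ⊢ ((□ A ∧' ◇ ([ j ] B)) ⇒ ◇ ([ j ] C)))
lemma2 V m = []-isS5 , ¬◇[]-from-independence , ◇[]-mono-under-□
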